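{- Let $\ell,k\in\mathbb{N}$ with $\ell\ge k+6$, and let $c_1\in\{0,\ldots,9\}$. For every $n\in\mathbb{N}_{\ell,k}(5^+;c_1)$ there exist digits $a_1,\ldots,a_{18},b_1,\ldots,b_{18}\in\{1,\ldots,9\}$ and a digit $c_2\in\{0,\ldots,9\}$ such that $$n-\sum_{j=1}^{18}q_{\ell-1,k}(a_j,b_j)\in\mathbb{N}_{\ell-1,k+1}(5^+;c_2).$$
   Context: Every $n\in\mathbb{N}=\{0,1,2,\ldots\}$ has a unique decimal representation $n=\sum_{j=0}^{L-1}10^j\delta_j$ with digits $\delta_j\in\{0,\ldots,9\}$ and $\delta_{L-1}\ne 0$ whenever $L\ge 2$; $L(n)\coloneqq L$. For integers $\ell,k\in\mathbb{N}$ with $\ell\ge k+4$ and digits $a,b$, define $q_{\ell,k}(a,b)\coloneqq 10^{\ell-1}a+10^{\ell-2}b+10^k(a+b)$. For integers $\ell\ge k+4$ and a digit $c$, $\mathbb{N}_{\ell,k}(5^+;c)$ denotes the set of natural numbers $n$ with $L(n)=\ell$, leading digit $\delta_{\ell-1}\ge 5$, digit $\delta_k=c$, and $10^k\mid n$. -}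

module Defs where

open import Data.Nat using (ℕ; zero; suc; _+_; _*_; _∸_; _^_; _≤_; _<_; _≥_)
open import Data.Nat.DivMod using (_/_; _%_)
open import Data.Nat.Divisibility using (_∣_)
open import Data.Fin using (Fin)
open import Data.Product using (_×_)
open import Relation.Binary.PropositionalEquality using (_≡_)

digit : ℕ → ℕ → ℕ
digit n zero    = n % 10
digit n (suc j) = digit (n / 10) j

-- number of decimal digits, computed with fuel; L(0) = 1
lenAux : ℕ → ℕ → ℕ
lenAux zero    n = 1
lenAux (suc f) n with n / 10
... | zero  = 1
... | suc m = suc (lenAux f (suc m))

-- L(n): fuel n suffices since n / 10 < n for n ≥ 1
L : ℕ → ℕ
L n = lenAux n n

q : ℕ → ℕ → ℕ → ℕ → ℕ
q ℓ k a b = 10 ^ (ℓ ∸ 1) * a + 10 ^ (ℓ ∸ 2) * b + 10 ^ k * (a + b)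

InN5+ : ℕ → ℕ → ℕ → ℕ → Set
InN5+ ℓ k c n =
  (L n ≡ ℓ) × (5 ≤ digit n (ℓ ∸ 1)) × (digit n k ≡ c) × (10 ^ k ∣ n)

sumFin : (m : ℕ) → (Fin m → ℕ) → ℕ
sumFin zero    f = 0
sumFin (suc m) f = f Fin.zero + sumFin m (λ i → f (Fin.suc i))

IsDigit : ℕ → Set
IsDigit d = d ≤ 9

IsNZDigit : ℕ → Set
IsNZDigit d = (1 ≤ d) × (d ≤ 9)

-- Write n = N·10^k and G = 10^(ℓ−k−3), so that 500·G ≤ N < 1000·G. For digit vectors with
-- sums A = Σ a_j and B = Σ b_j we have Σ q_{ℓ−1,k}(a_j, b_j) = (G·(10A + B) + A + B)·10^k,
-- and the sums of 18 nonzero digits are exactly the numbers in [18, 162]. So it suffices to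
-- find A, B ∈ [18, 162] with 10A + B = ⌊N/G⌋ − 51 and A + B ≡ N (mod 10): then
-- M = 51·G + (N mod G) − (A + B) lies in [50·G, 100·G) and is divisible by 10, hence
-- M·10^k ∈ ℕ_{ℓ−1,k+1}(5⁺). Ten consecutive candidate pairs with 10A + B fixed realise every
-- residue of A + B, which is where the freedom to hit N mod 10 comes from.
module Submission where

open import Defs
open import Data.Nat
open import Data.Nat.Properties
open import Data.Nat.DivMod
open import Data.Nat.Divisibility using (_∣_; divides; ∣-trans; m∣m*n; n∣m*n; *-monoˡ-∣; ∣m+n∣m⇒∣n)
open import Data.Nat.Tactic.RingSolver using (solve-∀)
open import Data.Fin using (Fin)
import Data.Fin as Fin
open import Data.Product using (Σ; ∃; _×_; _,_; proj₁; proj₂)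
open import Function using (_∘_)
open import Relation.Binary.PropositionalEquality
open import Relation.Nullary using (yes; no; contradiction)

m/n<o⇒m<n*o : ∀ {m n o} .{{_ : NonZero n}} → m / n < o → m < n * o
m/n<o⇒m<n*o {m} {n} {o} m/n<o = begin-strict
  m                 ≡⟨ m≡m%n+[m/n]*n m n ⟩
  m % n + m / n * n <⟨ +-monoˡ-< (m / n * n) (m%n<n m n) ⟩
  suc (m / n) * n   ≤⟨ *-monoˡ-≤ n m/n<o ⟩
  o * n             ≡⟨ *-comm o n ⟩
  n * o             ∎
  where open ≤-Reasoning

m*n≤o⇒m≤o/n : ∀ {m n o} .{{_ : NonZero n}} → m * n ≤ o → m ≤ o / n
m*n≤o⇒m≤o/n {m} {n} m*n≤o = subst (_≤ _) (m*n/n≡m m n) (/-monoˡ-≤ n m*n≤o)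

[m+n]%d≡n%d⇒d∣m : ∀ m n d .{{_ : NonZero d}} → (m + n) % d ≡ n % d → d ∣ m
[m+n]%d≡n%d⇒d∣m m n d eq = ∣m+n∣m⇒∣n (divides ((m + n) / d) shifted) (n∣m*n (n / d))
  where
  shifted : n / d * d + m ≡ (m + n) / d * d
  shifted = +-cancelˡ-≡ (n % d) _ _ (begin
    n % d + (n / d * d + m)       ≡⟨ sym (+-assoc (n % d) _ m) ⟩
    n % d + n / d * d + m         ≡⟨ cong (_+ m) (sym (m≡m%n+[m/n]*n n d)) ⟩
    n + m                         ≡⟨ +-comm n m ⟩
    m + n                         ≡⟨ m≡m%n+[m/n]*n (m + n) d ⟩
    (m + n) % d + (m + n) / d * d ≡⟨ cong (_+ (m + n) / d * d) eq ⟩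
    n % d + (m + n) / d * d       ∎)
    where open ≡-Reasoning

residue-in-window : ∀ d s c .{{_ : NonZero d}} → ∃ λ x → x < d × (s + x) % d ≡ c % d
residue-in-window d s c = y % d , m%n<n y d , hits-c
  where
  r : ℕ
  r = s % d
  y : ℕ
  y = d + c % d ∸ r
  hits-c : (s + y % d) % d ≡ c % d
  hits-c = begin
    (s + y % d) % d         ≡⟨ %-distribˡ-+ s (y % d) d ⟩
    (r + y % d % d) % d     ≡⟨ cong (λ z → (r + z) % d) (m%n%n≡m%n y d) ⟩
    (r + y % d) % d         ≡⟨ cong (λ z → (z + y % d) % d) (sym (m%n%n≡m%n s d)) ⟩
    (r % d + y % d) % d     ≡⟨ sym (%-distribˡ-+ r y d) ⟩
    (r + y) % d             ≡⟨ cong (_% d) (m+[n∸m]≡n (≤-trans (<⇒≤ (m%n<n s d)) (m≤m+n d (c % d)))) ⟩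
    (d + c % d) % d         ≡⟨ cong (_% d) (+-comm d (c % d)) ⟩
    (c % d + d) % d         ≡⟨ [m+n]%n≡m%n (c % d) d ⟩
    c % d % d               ≡⟨ m%n%n≡m%n c d ⟩
    c % d                   ∎
    where open ≡-Reasoning

pow-split : ∀ a i j k → a * 10 ^ (i + j + k) ≡ a * 10 ^ i * 10 ^ j * 10 ^ k
pow-split a i j k = trans
  (cong (a *_) (trans (^-distribˡ-+-* 10 (i + j) k) (cong (_* 10 ^ k) (^-distribˡ-+-* 10 i j))))
  (reassoc a (10 ^ i) (10 ^ j) (10 ^ k))
  where
  reassoc : ∀ a X Y Z → a * (X * Y * Z) ≡ a * X * Y * Z
  reassoc = solve-∀

n/10<fuel : ∀ {f m} n → n ≤ suc f → n / 10 ≡ suc m → suc m ≤ f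
n/10<fuel (suc n) (s≤s n≤f) eq =
  ≤-trans (≤-pred (subst (_< suc n) eq (m/n<m (suc n) 10 (s≤s (s≤s z≤n))))) n≤f

lenAux-upper : ∀ f n → n ≤ f → n < 10 ^ lenAux f n
lenAux-upper zero    zero _   = s≤s z≤n
lenAux-upper (suc f) n    n≤f with n / 10 in eq
... | zero  = m/n≡0⇒m<n eq
... | suc m = m/n<o⇒m<n*o
  (subst (_< 10 ^ lenAux f (suc m)) (sym eq) (lenAux-upper f (suc m) (n/10<fuel n n≤f eq)))

lenAux-exact : ∀ f n p → n ≤ f → 10 ^ p ≤ n → n < 10 ^ suc p → lenAux f n ≡ suc p
lenAux-exact zero zero p _ 10^p≤0 _ = contradiction 10^p≤0 (<⇒≱ (m^n>0 10 p))
lenAux-exact (suc f) n zero n≤f _ n<10 with n / 10 in eq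
... | zero  = refl
... | suc m = contradiction (trans (sym eq) (m<n⇒m/n≡0 n<10)) λ ()
lenAux-exact (suc f) n (suc p) n≤f lo hi with n / 10 in eq
... | zero  = contradiction (≤-trans (m≤m*n 10 (10 ^ p) {{m^n≢0 10 p}}) lo) (<⇒≱ (m/n≡0⇒m<n eq))
... | suc m = cong suc (lenAux-exact f (suc m) p (n/10<fuel n n≤f eq)
  (subst (10 ^ p ≤_) eq (m*n≤o⇒m≤o/n (subst (_≤ n) (*-comm 10 (10 ^ p)) lo)))
  (subst (_< 10 ^ suc p) eq (m<n*o⇒m/o<n (subst (n <_) (*-comm 10 (10 ^ suc p)) hi))))

n<10^L : ∀ n → n < 10 ^ L n
n<10^L n = lenAux-upper n n ≤-refl

L-exact : ∀ {n} p → 10 ^ p ≤ n → n < 10 ^ suc p → L n ≡ suc p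
L-exact {n} p = lenAux-exact n n p ≤-refl

digit≡ : ∀ n j → digit n j ≡ (n / 10 ^ j) {{m^n≢0 10 j}} % 10
digit≡ n zero    = cong (_% 10) (sym (n/1≡n n))
digit≡ n (suc j) = trans (digit≡ (n / 10) j)
  (cong (_% 10) (m/n/o≡m/[n*o] n 10 (10 ^ j) {{_}} {{m^n≢0 10 j}} {{m^n≢0 10 (suc j)}}))

digit≤9 : ∀ n j → digit n j ≤ 9
digit≤9 n zero    = ≤-pred (m%n<n n 10)
digit≤9 n (suc j) = digit≤9 (n / 10) j

digit-leading : ∀ n j → n < 10 ^ suc j → digit n j ≡ (n / 10 ^ j) {{m^n≢0 10 j}}
digit-leading n j n< = trans (digit≡ n j) (m<n⇒m%n≡m (m<n*o⇒m/o<n {{m^n≢0 10 j}} n<))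

≤digit⇒ : ∀ {d n} j → n < 10 ^ suc j → d ≤ digit n j → d * 10 ^ j ≤ n
≤digit⇒ {d} {n} j n< d≤digit = begin
  d * 10 ^ j                  ≤⟨ *-monoˡ-≤ (10 ^ j) (subst (d ≤_) (digit-leading n j n<) d≤digit) ⟩
  (n / 10 ^ j) {{_}} * 10 ^ j ≤⟨ m/n*n≤m n (10 ^ j) {{m^n≢0 10 j}} ⟩
  n                           ∎
  where open ≤-Reasoning

⇒≤digit : ∀ {d n} j → n < 10 ^ suc j → d * 10 ^ j ≤ n → d ≤ digit n j
⇒≤digit {d} {n} j n< d*10^j≤n =
  subst (d ≤_) (sym (digit-leading n j n<)) (m*n≤o⇒m≤o/n {{m^n≢0 10 j}} d*10^j≤n)

InN5+⇒bounds : ∀ {p k c n} → InN5+ (suc p) k c n → 5 * 10 ^ p ≤ n × n < 10 ^ suc p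
InN5+⇒bounds {p} {n = n} (L≡ , leading≥5 , _ , _) = ≤digit⇒ p n< leading≥5 , n<
  where
  n< : n < 10 ^ suc p
  n< = subst (λ ℓ → n < 10 ^ ℓ) L≡ (n<10^L n)

InN5+-intro : ∀ p k m → 5 * 10 ^ p ≤ m → m < 10 ^ suc p → 10 ^ k ∣ m → InN5+ (suc p) k (digit m k) m
InN5+-intro p k m lo hi 10^k∣m =
  L-exact p (≤-trans (m≤n*m (10 ^ p) 5) lo) hi , ⇒≤digit p hi lo , refl , 10^k∣m

q-zero : ∀ ℓ k → q ℓ k 0 0 ≡ 0
q-zero ℓ k = vanish (10 ^ (ℓ ∸ 1)) (10 ^ (ℓ ∸ 2)) (10 ^ k)
  where
  vanish : ∀ X Y Z → X * 0 + Y * 0 + Z * (0 + 0) ≡ 0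
  vanish = solve-∀

q-+ : ∀ ℓ k a b a′ b′ → q ℓ k a b + q ℓ k a′ b′ ≡ q ℓ k (a + a′) (b + b′)
q-+ ℓ k = linear (10 ^ (ℓ ∸ 1)) (10 ^ (ℓ ∸ 2)) (10 ^ k)
  where
  linear : ∀ X Y Z a b a′ b′ → X * a + Y * b + Z * (a + b) + (X * a′ + Y * b′ + Z * (a′ + b′))
                               ≡ X * (a + a′) + Y * (b + b′) + Z * (a + a′ + (b + b′))
  linear = solve-∀

sumFin-q : ∀ r ℓ k (a b : Fin r → ℕ) →
  sumFin r (λ i → q ℓ k (a i) (b i)) ≡ q ℓ k (sumFin r a) (sumFin r b)
sumFin-q zero    ℓ k a b = sym (q-zero ℓ k)
sumFin-q (suc r) ℓ k a b =
  trans (cong (q ℓ k (a Fin.zero) (b Fin.zero) +_) (sumFin-q r ℓ k (a ∘ Fin.suc) (b ∘ Fin.suc)))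
        (q-+ ℓ k (a Fin.zero) (b Fin.zero) _ _)

q-factor : ∀ j k a b → q (2 + j + k) k a b ≡ (10 ^ j * (10 * a + b) + (a + b)) * 10 ^ k
q-factor j k a b = begin
  10 ^ (1 + j + k) * a + 10 ^ (j + k) * b + 10 ^ k * (a + b)
    ≡⟨ cong₂ (λ X Y → X * a + Y * b + 10 ^ k * (a + b))
             (^-distribˡ-+-* 10 (1 + j) k) (^-distribˡ-+-* 10 j k) ⟩
  10 * 10 ^ j * 10 ^ k * a + 10 ^ j * 10 ^ k * b + 10 ^ k * (a + b)
    ≡⟨ factor (10 ^ j) (10 ^ k) a b ⟩
  (10 ^ j * (10 * a + b) + (a + b)) * 10 ^ k ∎
  where
  open ≡-Reasoning
  factor : ∀ G K a b → 10 * G * K * a + G * K * b + K * (a + b) ≡ (G * (10 * a + b) + (a + b)) * K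
  factor = solve-∀

NZDigitSum : ℕ → ℕ → Set
NZDigitSum r A = Σ (Fin r → ℕ) λ f → ((i : Fin r) → IsNZDigit (f i)) × sumFin r f ≡ A

cons-digit : ∀ {r A} d → IsNZDigit d → NZDigitSum r A → NZDigitSum (suc r) (d + A)
cons-digit d d-ok (f , f-ok , f-sum) =
  (λ { Fin.zero → d ; (Fin.suc i) → f i }) ,
  (λ { Fin.zero → d-ok ; (Fin.suc i) → f-ok i }) ,
  cong (d +_) f-sum

-- Witness-producing lemmas that are later used under `with` are kept opaque: with-abstraction
-- over a transparent call normalises the proof, which is prohibitively expensive here.
opaque
  nonzero-digit-sum : ∀ r A → r ≤ A → A ≤ 9 * r → NZDigitSum r A
  nonzero-digit-sum zero    A _   A≤0 = (λ ()) , (λ ()) , sym (n≤0⇒n≡0 A≤0)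
  nonzero-digit-sum (suc r) A r<A A≤9+9r with m≤n⇒∃[o]m+o≡n r<A
  ... | w , refl with w ≤? 8
  ...   | yes w≤8 = subst (NZDigitSum (suc r)) (cong suc (+-comm w r))
            (cons-digit (suc w) (s≤s z≤n , s≤s w≤8) (nonzero-digit-sum r r ≤-refl (m≤n*m r 9)))
  ...   | no w≰8 with m≤n⇒∃[o]m+o≡n (≰⇒> w≰8)
  ...     | v , refl = subst (NZDigitSum (suc r)) (shuffle r v)
            (cons-digit 9 (s≤s z≤n , ≤-refl) (nonzero-digit-sum r (r + suc v) (m≤m+n r (suc v)) rest≤9r))
    where
    shuffle : ∀ r v → 9 + (r + suc v) ≡ suc r + (9 + v)
    shuffle = solve-∀
    rest≤9r : r + suc v ≤ 9 * r
    rest≤9r = +-cancelˡ-≤ 9 _ _ (begin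
      9 + (r + suc v)  ≡⟨ shuffle r v ⟩
      suc r + (9 + v)  ≤⟨ A≤9+9r ⟩
      9 * suc r        ≡⟨ *-suc 9 r ⟩
      9 + 9 * r        ∎)
      where open ≤-Reasoning

-- With w = ⌊u/10⌋ and t = u mod 10, the pairs A = w − 20 + x, B = 149 + t − 10x (x ≤ 9) all
-- satisfy 10A + B + 51 = u, while A + B + 10x = (w − 20) + 149 + t + x runs through all residues.
opaque
  leading-split : ∀ u c → 500 ≤ u → u < 1000 → ∃ λ A → ∃ λ B →
    (18 ≤ A × A ≤ 162) × (18 ≤ B × B ≤ 162) × 10 * A + B + 51 ≡ u × (A + B) % 10 ≡ c % 10
  leading-split u c 500≤u u<1000 with residue-in-window 10 (u / 10 ∸ 20 + 149 + u % 10) c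
  ... | x , x<10 , window-residue = A , B , (A-lo , A-hi) , (B-lo , B-hi) , assembles , residue
    where
    w t s A B : ℕ
    w = u / 10
    t = u % 10
    s = w ∸ 20
    A = s + x
    B = 149 + t ∸ 10 * x
    w-lo : 50 ≤ w
    w-lo = m*n≤o⇒m≤o/n 500≤u
    w-hi : w < 100
    w-hi = m<n*o⇒m/o<n u<1000
    t≤9 : t ≤ 9
    t≤9 = ≤-pred (m%n<n u 10)
    x≤9 : x ≤ 9
    x≤9 = ≤-pred x<10
    B+10x : B + 10 * x ≡ 149 + t
    B+10x = m∸n+n≡m (≤-trans (*-monoʳ-≤ 10 x≤9) (m≤m+n 90 (59 + t)))
    s+20 : s + 20 ≡ w
    s+20 = m∸n+n≡m (≤-trans (m≤m+n 20 30) w-lo)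
    A-lo : 18 ≤ A
    A-lo = ≤-trans (m≤m+n 18 12) (≤-trans (∸-monoˡ-≤ 20 w-lo) (m≤m+n s x))
    A-hi : A ≤ 162
    A-hi = ≤-trans (+-mono-≤ (≤-trans (m∸n≤m w 20) (≤-pred w-hi)) x≤9) (m≤m+n 108 54)
    B-lo : 18 ≤ B
    B-lo = ≤-trans (m≤m+n 18 41) (+-cancelʳ-≤ 90 59 B (begin
      149           ≤⟨ m≤m+n 149 t ⟩
      149 + t       ≡⟨ sym B+10x ⟩
      B + 10 * x    ≤⟨ +-monoʳ-≤ B (*-monoʳ-≤ 10 x≤9) ⟩
      B + 90        ∎))
      where open ≤-Reasoning
    B-hi : B ≤ 162
    B-hi = ≤-trans (m∸n≤m (149 + t) (10 * x)) (+-monoʳ-≤ 149 (≤-trans t≤9 (m≤m+n 9 4)))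
    assembles : 10 * A + B + 51 ≡ u
    assembles = begin
      10 * (s + x) + B + 51       ≡⟨ distribute s x B ⟩
      10 * s + (B + 10 * x) + 51  ≡⟨ cong (λ z → 10 * s + z + 51) B+10x ⟩
      10 * s + (149 + t) + 51     ≡⟨ regroup s t ⟩
      t + (s + 20) * 10           ≡⟨ cong (λ z → t + z * 10) s+20 ⟩
      t + w * 10                  ≡⟨ sym (m≡m%n+[m/n]*n u 10) ⟩
      u                           ∎
      where
      open ≡-Reasoning
      distribute : ∀ s x B → 10 * (s + x) + B + 51 ≡ 10 * s + (B + 10 * x) + 51
      distribute = solve-∀
      regroup : ∀ s t → 10 * s + (149 + t) + 51 ≡ t + (s + 20) * 10
      regroup = solve-∀
    residue : (A + B) % 10 ≡ c % 10
    residue = begin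
      (A + B) % 10                ≡⟨ sym ([m+kn]%n≡m%n (A + B) x 10) ⟩
      (s + x + B + x * 10) % 10   ≡⟨ cong (_% 10) (collect s x B) ⟩
      (s + (B + 10 * x) + x) % 10 ≡⟨ cong (λ z → (s + z + x) % 10) B+10x ⟩
      (s + (149 + t) + x) % 10    ≡⟨ cong (λ z → (z + x) % 10) (sym (+-assoc s 149 t)) ⟩
      (s + 149 + t + x) % 10      ≡⟨ window-residue ⟩
      c % 10                      ∎
      where
      open ≡-Reasoning
      collect : ∀ s x B → s + x + B + x * 10 ≡ s + (B + 10 * x) + x
      collect = solve-∀

BlockSplit : ℕ → ℕ → Set
BlockSplit G N = ∃ λ A → ∃ λ B → ∃ λ M → (18 ≤ A × A ≤ 162) × (18 ≤ B × B ≤ 162) ×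
  N ≡ G * (10 * A + B) + (A + B) + M × 50 * G ≤ M × M < 100 * G × 10 ∣ M

block-split : ∀ G u ρ → 10 ∣ G → 324 ≤ G → ρ < G → 500 ≤ u → u < 1000 → BlockSplit G (ρ + u * G)
block-split G u ρ 10∣G 324≤G ρ<G 500≤u u<1000 with leading-split u ρ 500≤u u<1000
... | A , B , (A-lo , A-hi) , (B-lo , B-hi) , place , residue =
  A , B , M , (A-lo , A-hi) , (B-lo , B-hi) , regroup , M-lo , M-hi , 10∣M
  where
  M : ℕ
  M = 51 * G + ρ ∸ (A + B)
  A+B≤G : A + B ≤ G
  A+B≤G = ≤-trans (+-mono-≤ A-hi B-hi) 324≤G
  M+[A+B] : M + (A + B) ≡ 51 * G + ρ
  M+[A+B] = m∸n+n≡m (≤-trans A+B≤G (≤-trans (m≤m+n G (50 * G)) (m≤m+n (51 * G) ρ)))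
  regroup : ρ + u * G ≡ G * (10 * A + B) + (A + B) + M
  regroup = begin
    ρ + u * G                        ≡⟨ cong (λ v → ρ + v * G) (sym place) ⟩
    ρ + (10 * A + B + 51) * G        ≡⟨ distribute ρ (10 * A + B) G ⟩
    G * (10 * A + B) + (51 * G + ρ)  ≡⟨ cong (G * (10 * A + B) +_) (sym M+[A+B]) ⟩
    G * (10 * A + B) + (M + (A + B)) ≡⟨ +-assoc-comm (G * (10 * A + B)) M (A + B) ⟩
    G * (10 * A + B) + (A + B) + M   ∎
    where
    open ≡-Reasoning
    distribute : ∀ ρ X G → ρ + (X + 51) * G ≡ G * X + (51 * G + ρ)
    distribute = solve-∀
    +-assoc-comm : ∀ X M Y → X + (M + Y) ≡ X + Y + M
    +-assoc-comm = solve-∀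
  M-lo : 50 * G ≤ M
  M-lo = +-cancelʳ-≤ (A + B) (50 * G) M (begin
    50 * G + (A + B)   ≤⟨ +-monoʳ-≤ (50 * G) A+B≤G ⟩
    50 * G + G         ≡⟨ +-comm (50 * G) G ⟩
    51 * G             ≤⟨ m≤m+n (51 * G) ρ ⟩
    51 * G + ρ         ≡⟨ sym M+[A+B] ⟩
    M + (A + B)        ∎)
    where open ≤-Reasoning
  M-hi : M < 100 * G
  M-hi = begin-strict
    M                  ≤⟨ m≤m+n M (A + B) ⟩
    M + (A + B)        ≡⟨ M+[A+B] ⟩
    51 * G + ρ         <⟨ +-monoʳ-< (51 * G) ρ<G ⟩
    51 * G + G         ≡⟨ +-comm (51 * G) G ⟩
    52 * G             ≤⟨ *-monoˡ-≤ G (m≤m+n 52 48) ⟩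
    100 * G            ∎
    where open ≤-Reasoning
  10∣M : 10 ∣ M
  10∣M = [m+n]%d≡n%d⇒d∣m M (A + B) 10 (begin
    (M + (A + B)) % 10 ≡⟨ cong (_% 10) M+[A+B] ⟩
    (51 * G + ρ) % 10  ≡⟨ %-remove-+ˡ ρ (∣-trans 10∣G (n∣m*n 51)) ⟩
    ρ % 10             ≡⟨ sym residue ⟩
    (A + B) % 10       ∎)
    where open ≡-Reasoning

opaque
  InN5+⇒leading-block : ∀ i k {c} N → InN5+ (6 + i + k) k c (N * 10 ^ k) → ∃ λ u → ∃ λ ρ →
    N ≡ ρ + u * 10 ^ (3 + i) × ρ < 10 ^ (3 + i) × 500 ≤ u × u < 1000
  InN5+⇒leading-block i k N n∈ =
    (N / G) {{G≢0}} , (N % G) {{G≢0}} , m≡m%n+[m/n]*n N G {{G≢0}} , m%n<n N G {{G≢0}} ,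
    m*n≤o⇒m≤o/n {{G≢0}} N-lo , m<n*o⇒m/o<n {n = 1000} {{G≢0}} N-hi
    where
    G : ℕ
    G = 10 ^ (3 + i)
    G≢0 : NonZero G
    G≢0 = m^n≢0 10 (3 + i)
    N-lo : 500 * G ≤ N
    N-lo = *-cancelʳ-≤ (500 * G) N (10 ^ k) {{m^n≢0 10 k}}
      (subst (_≤ N * 10 ^ k) (pow-split 5 2 (3 + i) k) (proj₁ (InN5+⇒bounds {k = k} n∈)))
    N-hi : N < 1000 * G
    N-hi = *-cancelʳ-< (10 ^ k) N (1000 * G)
      (subst (N * 10 ^ k <_) (pow-split 10 2 (3 + i) k) (proj₂ (InN5+⇒bounds {k = k} n∈)))

InN5+-scaled : ∀ i k M → 50 * 10 ^ (3 + i) ≤ M → M < 100 * 10 ^ (3 + i) → 10 ∣ M →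
  InN5+ (5 + i + k) (k + 1) (digit (M * 10 ^ k) (k + 1)) (M * 10 ^ k)
InN5+-scaled i k M lo hi 10∣M = InN5+-intro (4 + i + k) (k + 1) (M * 10 ^ k)
  (subst (_≤ M * 10 ^ k) (sym (pow-split 5 1 (3 + i) k)) (*-monoˡ-≤ (10 ^ k) lo))
  (subst (M * 10 ^ k <_) (sym (pow-split 10 1 (3 + i) k)) (*-monoˡ-< (10 ^ k) {{m^n≢0 10 k}} hi))
  (subst (_∣ M * 10 ^ k) (cong (10 ^_) (+-comm 1 k)) (*-monoˡ-∣ (10 ^ k) 10∣M))

Reduct : ℕ → ℕ → ℕ → Set
Reduct ℓ k n = ∃ λ A → ∃ λ B → ∃ λ m →
  (18 ≤ A × A ≤ 162) × (18 ≤ B × B ≤ 162) × n ≡ q ℓ k A B + m × InN5+ ℓ (k + 1) (digit m (k + 1)) m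

block-reduct : ∀ i k u ρ → ρ < 10 ^ (3 + i) → 500 ≤ u → u < 1000 →
  Reduct (5 + i + k) k ((ρ + u * 10 ^ (3 + i)) * 10 ^ k)
block-reduct i k u ρ ρ<G u-lo u-hi =
  reduct (block-split (10 ^ (3 + i)) u ρ (m∣m*n (10 ^ (2 + i))) 324≤G ρ<G u-lo u-hi)
  where
  324≤G : 324 ≤ 10 ^ (3 + i)
  324≤G = ≤-trans (m≤m+n 324 676) (^-monoʳ-≤ 10 (m≤m+n 3 i))
  reduct : BlockSplit (10 ^ (3 + i)) (ρ + u * 10 ^ (3 + i)) →
           Reduct (5 + i + k) k ((ρ + u * 10 ^ (3 + i)) * 10 ^ k)
  reduct (A , B , M , A-range , B-range , split≡ , M-lo , M-hi , 10∣M) =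
    A , B , M * 10 ^ k , A-range , B-range , n≡ , InN5+-scaled i k M M-lo M-hi 10∣M
    where
    n≡ : (ρ + u * 10 ^ (3 + i)) * 10 ^ k ≡ q (5 + i + k) k A B + M * 10 ^ k
    n≡ = begin
      (ρ + u * 10 ^ (3 + i)) * 10 ^ k
        ≡⟨ cong (_* 10 ^ k) split≡ ⟩
      (10 ^ (3 + i) * (10 * A + B) + (A + B) + M) * 10 ^ k
        ≡⟨ *-distribʳ-+ (10 ^ k) (10 ^ (3 + i) * (10 * A + B) + (A + B)) M ⟩
      (10 ^ (3 + i) * (10 * A + B) + (A + B)) * 10 ^ k + M * 10 ^ k
        ≡⟨ cong (_+ M * 10 ^ k) (sym (q-factor (3 + i) k A B)) ⟩
      q (5 + i + k) k A B + M * 10 ^ k ∎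
      where open ≡-Reasoning

InN5+-reduct : ∀ i k {c} n → InN5+ (6 + i + k) k c n → Reduct (5 + i + k) k n
InN5+-reduct i k n n∈@(_ , _ , _ , divides N refl) with InN5+⇒leading-block i k N n∈
... | u , ρ , refl , ρ<G , u-lo , u-hi = block-reduct i k u ρ ρ<G u-lo u-hi

Reduct⇒digit-vectors : ∀ {ℓ k n} → Reduct ℓ k n →
  Σ (Fin 18 → ℕ) λ a → Σ (Fin 18 → ℕ) λ b → Σ ℕ λ c₂ → Σ ℕ λ m →
    ((i : Fin 18) → IsNZDigit (a i)) × ((i : Fin 18) → IsNZDigit (b i)) × IsDigit c₂ ×
    (n ≡ sumFin 18 (λ i → q ℓ k (a i) (b i)) + m) × InN5+ ℓ (k + 1) c₂ m
Reduct⇒digit-vectors {ℓ} {k} {n} (A , B , m , (A-lo , A-hi) , (B-lo , B-hi) , n≡ , m∈)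
  with nonzero-digit-sum 18 A A-lo A-hi | nonzero-digit-sum 18 B B-lo B-hi
... | a , a-digits , ΣA | b , b-digits , ΣB =
  a , b , digit m (k + 1) , m , a-digits , b-digits , digit≤9 m (k + 1) , n≡Σq+m , m∈
  where
  n≡Σq+m : n ≡ sumFin 18 (λ i → q ℓ k (a i) (b i)) + m
  n≡Σq+m = trans n≡ (cong (_+ m) (sym (trans (sumFin-q 18 ℓ k a b) (cong₂ (q ℓ k) ΣA ΣB))))

≥k+6⇒≡6+i+k : ∀ {ℓ k} → ℓ ≥ k + 6 → ∃ λ i → ℓ ≡ 6 + i + k
≥k+6⇒≡6+i+k {k = k} ℓ≥k+6 with m≤n⇒∃[o]m+o≡n ℓ≥k+6
... | i , refl = i , reorder k i
  where
  reorder : ∀ k i → k + 6 + i ≡ 6 + i + k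
  reorder = solve-∀

lemma2p4 : (ℓ k c₁ : ℕ) → ℓ ≥ k + 6 → IsDigit c₁ → (n : ℕ) → InN5+ ℓ k c₁ n →
    Σ (Fin 18 → ℕ) λ a → Σ (Fin 18 → ℕ) λ b → Σ ℕ λ c₂ → Σ ℕ λ m →
      ((i : Fin 18) → IsNZDigit (a i)) × ((i : Fin 18) → IsNZDigit (b i)) × IsDigit c₂ ×
      (n ≡ sumFin 18 (λ i → q (ℓ ∸ 1) k (a i) (b i)) + m) × InN5+ (ℓ ∸ 1) (k + 1) c₂ m
lemma2p4 ℓ k _ ℓ≥k+6 _ n n∈ with ≥k+6⇒≡6+i+k ℓ≥k+6
... | i , refl = Reduct⇒digit-vectors {5 + i + k} {k} (InN5+-reduct i k n n∈)
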